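{- There exist 2-edge-colorings (red/blue) of the complete graph $G$ on a countably infinite vertex set such that every vertex has infinitely many red and infinitely many blue incident edges, yet $G$ contains no $M_{1,\omega}$.
   Context: $M_{1,\omega}$ is the 2-edge-colored graph consisting of a vertex $v$ and a countably infinite set $R$ such that all pairs inside $R$ have one color and all edges from $v$ to $R$ have the other color. $G$ contains $M_{1,\omega}$ if it has a vertex $v$ and a countably infinite vertex set $R\not\ni v$ with this color pattern (for either assignment of the two colors). -}

module Defs where

open import Data.Nat using (ℕ; _<_)
open import Data.Bool using (Bool; true; false; not)
open import Data.Product using (Σ; ∃; _×_)
open import Relation.Binary.PropositionalEquality using (_≡_; _≢_)
open import Relation.Nullary using (¬_)

-- Colours: true = red, false = blue.
Colour : Set
Colour = Bool

-- Edges are unordered pairs {u , w} with u ≢ w; we represent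
-- a colouring as a function required to be symmetric. Values on the
-- diagonal c v v are irrelevant (no loops) and never used.
record Colouring : Set where
  field
    col : ℕ → ℕ → Colour
    sym : ∀ u w → col u w ≡ col w u
open Colouring public

InfinitelyManyIncident : Colouring → ℕ → Colour → Set
InfinitelyManyIncident c v k =
  ∀ m → ∃ λ w → (m < w) × (w ≢ v) × (col c v w ≡ k)

-- G contains M_{1,ω}: a vertex v and a countably infinite set R ∌ v
-- (given as the image of an injective map f : ℕ → ℕ) such that all pairs
-- inside R have colour k and all edges from v to R have the other colour.
ContainsM1ω : Colouring → Set
ContainsM1ω c =
  Σ ℕ λ v → Σ (ℕ → ℕ) λ f → Σ Colour λ k →
    (∀ i j → f i ≡ f j → i ≡ j) ×
    (∀ i → f i ≢ v) ×
    (∀ i j → i ≢ j → col c (f i) (f j) ≡ k) ×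
    (∀ i → col c v (f i) ≡ not k)

{-# OPTIONS --safe #-}

-- Colour an edge by the parity of its larger endpoint: every vertex sees both
-- parities infinitely often above it, but a vertex v and any two vertices
-- u < w of R above v force col u w = parity w = col v w.

module Submission where

open import Defs hiding (sym)
open import Data.Bool using (Bool; true; false; not; _≟_)
open import Data.Bool.Properties using (not-involutive; not-¬; ¬-not)
open import Data.Nat using (ℕ; zero; suc; _⊔_; _≤_; _<_; _≤?_)
open import Data.Nat.Properties
  using ( ⊔-comm; m≤n⇒m⊔n≡n; m≤m⊔n; m≤n⊔m; n<1+n; m<n⇒m<1+n
        ; <⇒≤; <-trans; ≤-<-trans; >⇒≢; <-irrefl; ≰⇒>)
open import Data.Fin using (Fin; toℕ; fromℕ<)
open import Data.Fin.Properties using (pigeonhole; fromℕ<-injective; ¬∀⟶∃¬)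
open import Data.Product using (Σ; ∃; _×_; _,_)
open import Function.Definitions using (Injective)
open import Relation.Binary.PropositionalEquality using (_≡_; refl; sym; trans; cong)
open import Relation.Nullary using (¬_; yes; no)

parity : ℕ → Bool
parity zero    = true
parity (suc n) = not (parity n)

parity-hits-above : ∀ n k → ∃ λ w → n < w × parity w ≡ k
parity-hits-above n k with parity (suc n) ≟ k
... | yes p = suc n , n<1+n n , p
... | no ¬p = suc (suc n) , m<n⇒m<1+n (n<1+n n) ,
              trans (cong not (¬-not ¬p)) (not-involutive k)

injective-unbounded : {f : ℕ → ℕ} → Injective _≡_ _≡_ f → ∀ n → ∃ λ j → n < f j
injective-unbounded {f} inj n
  with ¬∀⟶∃¬ (suc (suc n)) (λ i → f (toℕ i) ≤ n) (λ i → f (toℕ i) ≤? n) not-all-bounded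
  where
  not-all-bounded : ¬ (∀ (i : Fin (suc (suc n))) → f (toℕ i) ≤ n)
  not-all-bounded f≤n
    with pigeonhole (n<1+n (suc n)) (λ i → fromℕ< (≤-<-trans (f≤n i) (n<1+n n)))
  ... | i , j , i<j , same = <-irrefl (inj (fromℕ<-injective _ _ _ _ same)) i<j
... | i , f≰n = toℕ i , ≰⇒> f≰n

maxParity : Colouring
maxParity = record
  { col = λ u w → parity (u ⊔ w)
  ; sym = λ u w → cong parity (⊔-comm u w)
  }

maxParity-col : ∀ {u w} → u ≤ w → col maxParity u w ≡ parity w
maxParity-col u≤w = cong parity (m≤n⇒m⊔n≡n u≤w)

maxParity-infinitelyManyIncident : ∀ v k → InfinitelyManyIncident maxParity v k
maxParity-infinitelyManyIncident v k m with parity-hits-above (m ⊔ v) k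
... | w , m⊔v<w , parity-w = w , ≤-<-trans (m≤m⊔n m v) m⊔v<w , >⇒≢ v<w ,
                             trans (maxParity-col (<⇒≤ v<w)) parity-w
  where
  v<w : v < w
  v<w = ≤-<-trans (m≤n⊔m m v) m⊔v<w

maxParity-noM1ω : ¬ ContainsM1ω maxParity
maxParity-noM1ω (v , f , k , inj , _ , inside , fromV)
  with injective-unbounded (λ {i} {j} → inj i j) v
... | i , v<fi with injective-unbounded (λ {i} {j} → inj i j) (f i)
... | j , fi<fj = not-¬ k≡not-k (sym (not-involutive k))
  where
  colInside : parity (f j) ≡ k
  colInside = trans (sym (maxParity-col (<⇒≤ fi<fj)))
                    (inside i j (λ { refl → <-irrefl refl fi<fj }))

  k≡not-k : k ≡ not k
  k≡not-k = trans (sym colInside)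
                  (trans (sym (maxParity-col (<⇒≤ (<-trans v<fi fi<fj)))) (fromV j))

proposition4 : Σ Colouring λ c →
    ((v : _) → InfinitelyManyIncident c v true × InfinitelyManyIncident c v false) ×
    ¬ ContainsM1ω c
proposition4 =
  maxParity ,
  (λ v → maxParity-infinitelyManyIncident v true , maxParity-infinitelyManyIncident v false) ,
  maxParity-noM1ω
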